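{- Let $\mathbf P=(P,\leq,0,1)$ be a bounded poset which is the horizontal sum of a family of bounded posets $\mathbf P_\alpha=(P_\alpha,\leq_\alpha,0,1)$, $\alpha\in\Lambda$. Then the Dedekind-MacNeille completion $\mathrm{DM}(\mathbf P)$ is order-isomorphic to the horizontal sum of the complete lattices $\mathrm{DM}(\mathbf P_\alpha)$, $\alpha\in\Lambda$.
   Context: For a poset $(P,\leq)$ and $M\subseteq P$, $U(M)=\{x\in P\mid y\leq x \text{ for all } y\in M\}$ and $L(M)=\{x\in P\mid x\leq y\text{ for all }y\in M\}$; $LU(M)$ means $L(U(M))$. The Dedekind-MacNeille completion $\mathrm{DM}(\mathbf P)$ is the complete lattice $(\{B\subseteq P\mid LU(B)=B\},\subseteq)$, into which $P$ is embedded by $x\mapsto L(x)$. The horizontal sum of a family of bounded posets is obtained from their disjoint union by identifying all the top elements into one element $1$ and all the bottom elements into one element $0$; thus $x\leq y$ holds iff $x=0$, or $y=1$, or $x,y$ lie in the same summand $P_\alpha$ and $x\leq_\alpha y$. -}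

module Defs where

open import Level using (Level; _⊔_; suc; Lift; lift)
open import Data.Unit using (⊤)
open import Data.Empty using (⊥)
open import Data.Product using (Σ; _×_; _,_; proj₁; proj₂)
open import Relation.Unary using (Pred; _⊆_)
open import Relation.Binary using (Rel; Poset; Maximum; Minimum)

record RawBounded (c ℓ : Level) : Set (suc (c ⊔ ℓ)) where
  field
    Carrier : Set c
    _≤_     : Rel Carrier ℓ
    top     : Carrier
    bot     : Carrier

record BoundedPoset (c ℓ₁ ℓ₂ : Level) : Set (suc (c ⊔ ℓ₁ ⊔ ℓ₂)) where
  field
    poset   : Poset c ℓ₁ ℓ₂
  open Poset poset public
  field
    ⊤ₚ      : Carrier
    ⊥ₚ      : Carrier
    maximum : Maximum _≤_ ⊤ₚ
    minimum : Minimum _≤_ ⊥ₚ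

  raw : RawBounded c ℓ₂
  raw = record { Carrier = Carrier ; _≤_ = _≤_ ; top = ⊤ₚ ; bot = ⊥ₚ }

module Cones {c ℓ} (P : RawBounded c ℓ) where
  open RawBounded P

  U : Pred Carrier (c ⊔ ℓ) → Pred Carrier (c ⊔ ℓ)
  U M x = ∀ {y} → M y → y ≤ x

  L : Pred Carrier (c ⊔ ℓ) → Pred Carrier (c ⊔ ℓ)
  L M x = ∀ {y} → M y → x ≤ y

  LU : Pred Carrier (c ⊔ ℓ) → Pred Carrier (c ⊔ ℓ)
  LU M = L (U M)

  -- LU(B) = B; the inclusion B ⊆ LU(B) holds always, so closedness
  -- amounts to LU(B) ⊆ B.
  Closed : Pred Carrier (c ⊔ ℓ) → Set (c ⊔ ℓ)
  Closed B = LU B ⊆ B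

  LU-closed : (M : Pred Carrier (c ⊔ ℓ)) → Closed (LU M)
  LU-closed M x∈ u∈UM = x∈ (λ z∈LUM → z∈LUM u∈UM)

  ∅ : Pred Carrier (c ⊔ ℓ)
  ∅ _ = Lift (c ⊔ ℓ) ⊥

  Full : Pred Carrier (c ⊔ ℓ)
  Full _ = Lift (c ⊔ ℓ) ⊤

DM : ∀ {c ℓ} → RawBounded c ℓ → RawBounded (suc (c ⊔ ℓ)) (c ⊔ ℓ)
DM {c} {ℓ} P = record
  { Carrier = Σ (Pred Carrier (c ⊔ ℓ)) Closed
  ; _≤_     = λ B C → proj₁ B ⊆ proj₁ C
  ; top     = Full , λ _ → lift _
  ; bot     = LU ∅ , LU-closed ∅
  }
  where open RawBounded P
        open Cones P

-- An element of a summand is "bottom" (identified with 0) if it is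
-- below that summand's 0, and "top" (identified with 1) if it is
-- above that summand's 1.  Equality in the sum is mutual ≤.

module HorizontalSum {a c ℓ} (Λ : Set a) (P : Λ → RawBounded c ℓ) where
  open RawBounded

  data HCarrier : Set (a ⊔ c) where
    0ₕ  : HCarrier
    1ₕ  : HCarrier
    emb : (α : Λ) → Carrier (P α) → HCarrier

  IsBot : HCarrier → Set ℓ
  IsBot 0ₕ        = Lift ℓ ⊤
  IsBot 1ₕ        = Lift ℓ ⊥
  IsBot (emb α x) = _≤_ (P α) x (bot (P α))

  IsTop : HCarrier → Set ℓ
  IsTop 0ₕ        = Lift ℓ ⊥
  IsTop 1ₕ        = Lift ℓ ⊤
  IsTop (emb α x) = _≤_ (P α) (top (P α)) x

  data _≤ₕ_ : HCarrier → HCarrier → Set (a ⊔ c ⊔ ℓ) where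
    low  : ∀ {x y} → IsBot x → x ≤ₕ y
    high : ∀ {x y} → IsTop y → x ≤ₕ y
    same : ∀ {α} {x y : Carrier (P α)} → _≤_ (P α) x y → emb α x ≤ₕ emb α y

  HS : RawBounded (a ⊔ c) (a ⊔ c ⊔ ℓ)
  HS = record { Carrier = HCarrier ; _≤_ = _≤ₕ_ ; top = 1ₕ ; bot = 0ₕ }

HSum : ∀ {a c ℓ} (Λ : Set a) → (Λ → RawBounded c ℓ) → RawBounded (a ⊔ c) (a ⊔ c ⊔ ℓ)
HSum Λ P = HorizontalSum.HS Λ P

-- Order isomorphism (equality on both sides is mutual ≤, i.e. the
-- equality of the underlying posets: extensional equality of subsets
-- for DM, the identification of bounds for horizontal sums).

record _≅_ {c₁ ℓ₁ c₂ ℓ₂} (A : RawBounded c₁ ℓ₁) (B : RawBounded c₂ ℓ₂)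
       : Set (c₁ ⊔ ℓ₁ ⊔ c₂ ⊔ ℓ₂) where
  private
    module A = RawBounded A
    module B = RawBounded B
  field
    to        : A.Carrier → B.Carrier
    from      : B.Carrier → A.Carrier
    to-mono   : ∀ {x y} → x A.≤ y → to x B.≤ to y
    to-refl   : ∀ {x y} → to x B.≤ to y → x A.≤ y
    from-to   : ∀ x → (from (to x) A.≤ x) × (x A.≤ from (to x))
    to-from   : ∀ y → (to (from y) B.≤ y) × (y B.≤ to (from y))

module Submission where

-- Classically (excluded middle is assumed), a closed set B ⊆ P has one
-- of three shapes:
--   * B ∋ 1, and then B is all of P;
--   * B consists of bottom elements only, and then B = LU(∅);
--   * B contains a non-bottom element of some summand α; then all its
--     non-bottom elements lie in that one summand, and B is determined
--     by its restriction B↾α, which is closed in Pα.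
-- The isomorphism sends these shapes to 1, 0 and the summand element
-- B↾α of DM(Pα); its inverse sends C ∈ DM(Pα) to LU(C) computed in P.

open import Defs
open import Level using (Level; lift; lower)
open import Axiom.ExcludedMiddle using (ExcludedMiddle)
open import Relation.Binary using (Transitive)
open import Relation.Unary using (Pred; _⊆_)
open import Relation.Nullary using (¬_; yes; no)
open import Relation.Nullary.Decidable using (decidable-stable)
open import Relation.Binary.PropositionalEquality using (_≡_; refl)
open import Data.Product using (Σ; _×_; _,_; proj₁; proj₂)
open import Data.Empty using (⊥-elim)
open import Data.Unit using (tt)

module ConeFacts {c ℓ} (P : RawBounded c ℓ) where
  open RawBounded P
  open Cones P

  LU-extensive : ∀ {M} → M ⊆ LU M
  LU-extensive m u∈U = u∈U m

  LU-least : ∀ {M B} → Closed B → M ⊆ B → LU M ⊆ B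
  LU-least cl M⊆B x∈ = cl (λ u∈U → x∈ (λ m → u∈U (M⊆B m)))

  LU∅-least : ∀ {x y} → LU ∅ x → x ≤ y
  LU∅-least x∈ = x∈ (λ { (lift ()) })

  least-∈-closed : ∀ {B x} → Closed B → (∀ {y} → x ≤ y) → B x
  least-∈-closed cl least = cl (λ _ → least)

  closed-downward : Transitive _≤_ → ∀ {B x y} → Closed B → B y → x ≤ y → B x
  closed-downward tr cl y∈ x≤y = cl (λ u∈U → tr x≤y (u∈U y∈))

module BoundedFacts {c ℓ₁ ℓ₂} (P : BoundedPoset c ℓ₁ ℓ₂) where
  open BoundedPoset P

  below-⊥ : ∀ {x y} → x ≤ ⊥ₚ → x ≤ y
  below-⊥ {y = y} x≤⊥ = trans x≤⊥ (minimum y)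

  above-⊤ : ∀ {x y} → ⊤ₚ ≤ y → x ≤ y
  above-⊤ {x = x} ⊤≤y = trans (maximum x) ⊤≤y

module SumOrder {a c ℓ₁ ℓ₂} (Λ : Set a) (P : Λ → BoundedPoset c ℓ₁ ℓ₂) where
  open HorizontalSum Λ (λ α → BoundedPoset.raw (P α)) public
    using (HCarrier; 0ₕ; 1ₕ; emb; IsBot; IsTop; _≤ₕ_; low; high; same)

  Car : Λ → Set c
  Car α = BoundedPoset.Carrier (P α)

  Le : (α : Λ) → Car α → Car α → Set ℓ₂
  Le α = BoundedPoset._≤_ (P α)
  syntax Le α x y = x ≤[ α ] y

  1≤-inv : ∀ {w} → 1ₕ ≤ₕ w → IsTop w
  1≤-inv (low (lift ()))
  1≤-inv (high t) = t

  ≤0-inv : ∀ {w} → w ≤ₕ 0ₕ → IsBot w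
  ≤0-inv (low b) = b
  ≤0-inv (high (lift ()))

  emb-≤-inv : ∀ {α} {x y : Car α} → emb α x ≤ₕ emb α y → x ≤[ α ] y
  emb-≤-inv {α} (low x≤⊥) = BoundedFacts.below-⊥ (P α) x≤⊥
  emb-≤-inv {α} (high ⊤≤y) = BoundedFacts.above-⊤ (P α) ⊤≤y
  emb-≤-inv (same x≤y) = x≤y

  cross-≤-inv : ∀ {α β} {x : Car α} {y : Car β} → ¬ α ≡ β → ¬ IsTop (emb β y) →
                emb α x ≤ₕ emb β y → IsBot (emb α x)
  cross-≤-inv _ _ (low b) = b
  cross-≤-inv _ nt (high t) = ⊥-elim (nt t)
  cross-≤-inv α≢β _ (same _) = ⊥-elim (α≢β refl)

  common-upper-bound : ∀ {α β} {x : Car α} {y : Car β} {u} → ¬ α ≡ β →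
                       ¬ IsBot (emb α x) → ¬ IsBot (emb β y) →
                       emb α x ≤ₕ u → emb β y ≤ₕ u → IsTop u
  common-upper-bound _ nbx _ (low bx) _ = ⊥-elim (nbx bx)
  common-upper-bound _ _ _ (high t) _ = t
  common-upper-bound _ _ nby (same _) (low by) = ⊥-elim (nby by)
  common-upper-bound _ _ _ (same _) (high t) = t
  common-upper-bound α≢β _ _ (same _) (same _) = ⊥-elim (α≢β refl)

-- The isomorphism DM(⊕ Pα) ≅ ⊕ DM(Pα); excluded middle is used to
-- classify closed sets, transitivity of the sum order in `1-if-top`.
module Completion {a : Level} (em : ∀ {ℓ} → ExcludedMiddle ℓ) (Λ : Set a)
  (P : Λ → BoundedPoset a a a)
  (tr : Transitive (HorizontalSum._≤ₕ_ Λ (λ α → BoundedPoset.raw (P α)))) where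

  open SumOrder Λ P

  R : Λ → RawBounded a a
  R α = BoundedPoset.raw (P α)

  H : RawBounded a a
  H = HSum Λ R

  module T = HorizontalSum Λ (λ α → DM (R α))
  open Cones H
  open ConeFacts H

  _↾_ : Pred HCarrier a → (α : Λ) → Pred (Car α) a
  (B ↾ α) x = B (emb α x)

  Image : (α : Λ) → Pred (Car α) a → Pred HCarrier a
  Image α C z = Σ (Car α) λ x → C x × z ≡ emb α x

  -- Restricting a closed set to a summand gives a closed set: every upper
  -- bound w of B yields an upper bound of B↾α dominated by w.
  restrict-closed : ∀ {B} → Closed B → ∀ α → Cones.Closed (R α) (B ↾ α)
  restrict-closed {B} cl α {x} x∈ = cl below-every-bound
    where
    below-every-bound : ∀ {w} → U B w → emb α x ≤ₕ w
    below-every-bound {0ₕ} w∈U = low (x∈ (λ z∈ → ≤0-inv (w∈U z∈)))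
    below-every-bound {1ₕ} _ = high (lift tt)
    below-every-bound {emb β y} w∈U with em {P = α ≡ β}
    ... | yes refl = same (x∈ (λ z∈ → emb-≤-inv (w∈U z∈)))
    ... | no α≢β with em {P = IsTop (emb β y)}
    ...   | yes t = high t
    ...   | no nt = low (x∈ (λ z∈ → cross-≤-inv α≢β nt (w∈U z∈)))

  bottom-∈ : ∀ {B z} → Closed B → IsBot z → B z
  bottom-∈ cl b = least-∈-closed cl (low b)

  full-if-1 : ∀ {B z} → Closed B → B 1ₕ → B z
  full-if-1 cl b1 = cl (λ u∈U → high (1≤-inv (u∈U b1)))

  1-if-top : ∀ {B β} {y : Car β} → Closed B → B (emb β y) → IsTop (emb β y) → B 1ₕ
  1-if-top cl y∈ t = closed-downward tr cl y∈ (high t)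

  same-summand : ∀ {B α β} {x : Car α} {y : Car β} → Closed B → ¬ B 1ₕ →
                 B (emb α x) → ¬ IsBot (emb α x) →
                 B (emb β y) → ¬ IsBot (emb β y) → α ≡ β
  same-summand cl no1 x∈ nbx y∈ nby = decidable-stable em λ α≢β →
    no1 (cl (λ u∈U → high (common-upper-bound α≢β nbx nby (u∈U x∈) (u∈U y∈))))

  data InSummand (α : Λ) : HCarrier → Set a where
    bottom : ∀ {z} → IsBot z → InSummand α z
    inside : (x : Car α) → InSummand α (emb α x)

  confined : ∀ {B α z} {x : Car α} → Closed B → ¬ B 1ₕ →
             B (emb α x) → ¬ IsBot (emb α x) → B z → InSummand α z
  confined {z = 0ₕ} _ _ _ _ _ = bottom (lift tt)
  confined {z = 1ₕ} _ no1 _ _ b1 = ⊥-elim (no1 b1)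
  confined {z = emb β y} cl no1 x∈ nbx y∈ with em {P = IsBot (emb β y)}
  ... | yes b = bottom b
  ... | no nby with same-summand cl no1 x∈ nbx y∈ nby
  ...   | refl = inside y

  -- The three shapes of a closed set, indexed by its image in ⊕ DM(Pα).
  data Shape (B : Pred HCarrier a) (cl : Closed B) : T.HCarrier → Set (Level.suc a) where
    top : B 1ₕ → Shape B cl T.1ₕ
    mid : ∀ {α x} → ¬ B 1ₕ → B (emb α x) → ¬ IsBot (emb α x) →
          Shape B cl (T.emb α (B ↾ α , restrict-closed cl α))
    bot : (∀ {z} → B z → IsBot z) → Shape B cl T.0ₕ

  NonBottomIn : Pred HCarrier a → Set a
  NonBottomIn B = Σ Λ λ α → Σ (Car α) λ x → B (emb α x) × ¬ IsBot (emb α x)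

  all-bottom : ∀ {B} → ¬ B 1ₕ → ¬ NonBottomIn B → ∀ {z} → B z → IsBot z
  all-bottom _ _ {0ₕ} _ = lift tt
  all-bottom no1 _ {1ₕ} b1 = ⊥-elim (no1 b1)
  all-bottom _ none {emb α x} x∈ = decidable-stable em (λ nbx → none (α , x , x∈ , nbx))

  shape : (B : Pred HCarrier a) (cl : Closed B) → Σ T.HCarrier (Shape B cl)
  shape B cl with em {P = B 1ₕ}
  ... | yes b1 = _ , top b1
  ... | no no1 with em {P = NonBottomIn B}
  ...   | yes (_ , _ , x∈ , nbx) = _ , mid no1 x∈ nbx
  ...   | no none = _ , bot (all-bottom {B} no1 none)

  DMH : Set (Level.suc a)
  DMH = RawBounded.Carrier (DM H)

  to : DMH → T.HCarrier
  to (B , cl) = proj₁ (shape B cl)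

  shape-of : (B : DMH) → Shape (proj₁ B) (proj₂ B) (to B)
  shape-of (B , cl) = proj₂ (shape B cl)

  from : T.HCarrier → DMH
  from T.0ₕ = LU ∅ , LU-closed ∅
  from T.1ₕ = Full , λ _ → lift tt
  from (T.emb α (C , _)) = LU (Image α C) , LU-closed (Image α C)

  shape-mono : ∀ {B D} {clB : Closed B} {clD : Closed D} {X Y} → Shape B clB X → Shape D clD Y → B ⊆ D → X T.≤ₕ Y
  shape-mono _ (top _) _ = T.high (lift tt)
  shape-mono (bot _) _ _ = T.low (lift tt)
  shape-mono (top b1) (mid no1 _ _) B⊆D = ⊥-elim (no1 (B⊆D b1))
  shape-mono (top b1) (bot all) B⊆D = ⊥-elim (lower (all (B⊆D b1)))
  shape-mono (mid _ x∈ nbx) (bot all) B⊆D = ⊥-elim (nbx (all (B⊆D x∈)))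
  shape-mono {clD = clD} (mid _ x∈ nbx) (mid no1 y∈ nby) B⊆D
    with same-summand clD no1 (B⊆D x∈) nbx y∈ nby
  ... | refl = T.same B⊆D

  shape-bottom : ∀ {B} {cl : Closed B} {X z} → Shape B cl X → T.IsBot X → B z → IsBot z
  shape-bottom (top _) (lift ())
  shape-bottom (mid {α} _ x∈ nbx) below _ = ⊥-elim (nbx (ConeFacts.LU∅-least (R α) (below x∈)))
  shape-bottom (bot all) _ z∈ = all z∈

  shape-top : ∀ {D} {cl : Closed D} {Y} → Shape D cl Y → T.IsTop Y → D 1ₕ
  shape-top (top d1) _ = d1
  shape-top {cl = cl} (mid {α} _ _ _) full =
    1-if-top cl (full (lift tt)) (BoundedPoset.refl (P α))
  shape-top (bot _) (lift ())

  shape-reflect : ∀ {B D} {clB : Closed B} {clD : Closed D} {X Y} → Shape B clB X → Shape D clD Y → X T.≤ₕ Y → B ⊆ D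
  shape-reflect {clD = clD} sB _ (T.low b) z∈ = bottom-∈ clD (shape-bottom sB b z∈)
  shape-reflect {clD = clD} _ sD (T.high t) _ = full-if-1 clD (shape-top sD t)
  shape-reflect {clB = clB} {clD} (mid no1 x∈ nbx) (mid _ _ _) (T.same ↾⊆↾) z∈
    with confined clB no1 x∈ nbx z∈
  ... | bottom b = bottom-∈ clD b
  ... | inside _ = ↾⊆↾ z∈

  shape-from : ∀ {B} {cl : Closed B} {X} → Shape B cl X → (proj₁ (from X) ⊆ B) × (B ⊆ proj₁ (from X))
  shape-from {cl = cl} (top b1) = (λ _ → full-if-1 cl b1) , (λ _ → lift tt)
  shape-from {cl = cl} (bot all) = LU-least cl (λ { (lift ()) }) , (λ z∈ _ → low (all z∈))
  shape-from {B} {cl} (mid {α} no1 x∈ nbx) = LU-least cl image⊆B , B⊆closure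
    where
    image⊆B : Image α (B ↾ α) ⊆ B
    image⊆B (_ , y∈ , refl) = y∈

    B⊆closure : B ⊆ LU (Image α (B ↾ α))
    B⊆closure z∈ with confined cl no1 x∈ nbx z∈
    ... | bottom b = λ _ → low b
    ... | inside y = LU-extensive (y , z∈ , refl)

  image-restrict : ∀ {α C} {x : Car α} → Cones.Closed (R α) C → LU (Image α C) (emb α x) → C x
  image-restrict clC x∈ = clC (λ u∈U → emb-≤-inv (x∈ (λ { (_ , c∈ , refl) → same (u∈U c∈) })))

  image-summand : ∀ {α β C} {x : Car β} → ¬ LU (Image α C) 1ₕ →
                  LU (Image α C) (emb β x) → ¬ IsBot (emb β x) → α ≡ β
  image-summand {α} {C = C} no1 x∈ nbx with em {P = Σ (Car α) λ c → C c × ¬ IsBot (emb α c)}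
  ... | yes (c , c∈ , nbc) =
    same-summand (LU-closed (Image α C)) no1 (LU-extensive (c , c∈ , refl)) nbc x∈ nbx
  ... | no none = ⊥-elim (nbx (≤0-inv (x∈ 0-bounds-image)))
    where
    0-bounds-image : U (Image α C) 0ₕ
    0-bounds-image (c , c∈ , refl) = low (decidable-stable em (λ nbc → none (c , c∈ , nbc)))

  shape-to : ∀ y {X} → Shape (proj₁ (from y)) (proj₂ (from y)) X → (X T.≤ₕ y) × (y T.≤ₕ X)
  shape-to T.0ₕ (top b1) = ⊥-elim (lower (≤0-inv (LU∅-least b1)))
  shape-to T.0ₕ (mid _ x∈ nbx) = ⊥-elim (nbx (≤0-inv (LU∅-least x∈)))
  shape-to T.0ₕ (bot _) = T.low (lift tt) , T.low (lift tt)
  shape-to T.1ₕ (top _) = T.high (lift tt) , T.high (lift tt)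
  shape-to T.1ₕ (mid no1 _ _) = ⊥-elim (no1 (lift tt))
  shape-to T.1ₕ (bot all) = ⊥-elim (lower (all {1ₕ} (lift tt)))
  shape-to (T.emb α (C , clC)) (top b1) =
    T.high (λ _ → image-restrict clC (full-if-1 (LU-closed (Image α C)) b1)) , T.high (lift tt)
  shape-to (T.emb α (C , clC)) (bot all) =
    T.low (lift tt) ,
    T.low (λ c∈ _ → BoundedFacts.below-⊥ (P α) (all (LU-extensive (_ , c∈ , refl))))
  shape-to (T.emb α (C , clC)) (mid no1 x∈ nbx) with image-summand no1 x∈ nbx
  ... | refl = T.same (image-restrict clC) , T.same (λ c∈ → LU-extensive (_ , c∈ , refl))

  iso : DM H ≅ T.HS
  iso = record
    { to      = to
    ; from    = from
    ; to-mono = λ {B} {D} → shape-mono (shape-of B) (shape-of D)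
    ; to-refl = λ {B} {D} → shape-reflect (shape-of B) (shape-of D)
    ; from-to = λ B → shape-from (shape-of B)
    ; to-from = λ y → shape-to y (shape-of (from y))
    }

proposition3 : ∀ {a : Level} → (∀ {ℓ} → ExcludedMiddle ℓ) →
    (Λ : Set a) (P : Λ → BoundedPoset a a a) →
    Transitive (RawBounded._≤_ (HSum Λ (λ α → BoundedPoset.raw (P α)))) →
    DM (HSum Λ (λ α → BoundedPoset.raw (P α)))
      ≅ HSum Λ (λ α → DM (BoundedPoset.raw (P α)))
proposition3 em Λ P tr = Completion.iso em Λ P tr
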